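{- Let $L_5=\{ -3,-2,-1,0,1\}$ with its natural order. Define games over $L_5$: $\star=\{ -1\mid -3\}$, and for a game $G$: $M(G)=\{1\mid G\}$, $P(G)=\{G\mid -2\}$, $P_\star(G)=\{G\mid \star\}$; for $n\in\mathbb{N}$ let $P_n(G)=P(G)$ if $n$ is odd and $P_n(G)=P_\star(G)$ if $n$ is even. Define $G_0=0$ (the atomic game $[0]$) and $G_{n+1}=M(P_n(G_n))$. Then for all $n\in\mathbb{N}$, $0\leq G_n$.
   Context: Games over a poset $A$ (whose elements are called atoms) are defined inductively: for each $a\in A$, $[a]$ is a game (atomic game, often written simply $a$); and whenever $L$ and $R$ are non-empty sets of games, $\{L\mid R\}$ is a game, whose elements of $L$ (resp. $R$) are its left options $G^L$ (resp. right options $G^R$); $\{G_1,\dots\mid H_1,\dots\}$ denotes the game with those left and right options. Relations $\leq$ and $\lhd$ are defined by mutual recursion: $G\leq H$ iff (1) every left option $G^L$ satisfies $G^L\lhd H$, (2) every right option $H^R$ satisfies $G\lhd H^R$, and (3) if $G$ or $H$ is atomic then $G\lhd H$. And $G\lhd H$ iff at least one of: (1) some right option $G^R$ satisfies $G^R\leq H$, (2) some left option $H^L$ satisfies $G\leq H^L$, (3) $G=[a]$, $H=[b]$ are atomic with $a\leq b$. -}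

module Defs where

open import Data.List using (List; _∷_; [])
open import Data.List.NonEmpty using (List⁺; [_]; toList)
open import Data.List.Relation.Unary.All using (All)
open import Data.List.Relation.Unary.Any using (Any)
open import Data.Sum using (_⊎_)
open import Data.Nat using (ℕ; zero; suc)
open import Data.Fin using (Fin)
import Data.Fin as F

data Game (A : Set) : Set where
  atom : A → Game A
  ⟨_∣_⟩ : List⁺ (Game A) → List⁺ (Game A) → Game A

module _ {A : Set} where
  leftOpts : Game A → List (Game A)
  leftOpts (atom _) = []
  leftOpts ⟨ L ∣ R ⟩ = toList L

  rightOpts : Game A → List (Game A)
  rightOpts (atom _) = []
  rightOpts ⟨ L ∣ R ⟩ = toList R

  data IsAtomic : Game A → Set where
    is-atom : (a : A) → IsAtomic (atom a)

-- The relations ≤ and ⊲ over a poset of atoms (with order _≼_),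
-- defined by mutual recursion as in the paper (as inductive families;
-- since games are well-founded this coincides with the recursive definition).
module Order {A : Set} (_≼_ : A → A → Set) where
  mutual
    data _≤G_ (G H : Game A) : Set where
      le : All (λ GL → GL ⊲ H) (leftOpts G)
         → All (λ HR → G ⊲ HR) (rightOpts H)
         → (IsAtomic G ⊎ IsAtomic H → G ⊲ H)
         → G ≤G H

    data _⊲_ : Game A → Game A → Set where
      tf-right : ∀ {G H} → Any (λ GR → GR ≤G H) (rightOpts G) → G ⊲ H
      tf-left  : ∀ {G H} → Any (λ HL → G ≤G HL) (leftOpts H) → G ⊲ H
      tf-atom  : ∀ {a b} → a ≼ b → atom a ⊲ atom b

-- L5 = {-3,-2,-1,0,1} with its natural order, represented by Fin 5
-- via i ↦ i - 3 (order-preserving).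
L5 : Set
L5 = Fin 5

_≤L5_ : L5 → L5 → Set
_≤L5_ = F._≤_

m3 m2 m1 z0 p1 : L5
m3 = F.zero
m2 = F.suc F.zero
m1 = F.suc (F.suc F.zero)
z0 = F.suc (F.suc (F.suc F.zero))
p1 = F.suc (F.suc (F.suc (F.suc F.zero)))

open Order _≤L5_ public

G5 : Set
G5 = Game L5

star : G5
star = ⟨ [ atom m1 ] ∣ [ atom m3 ] ⟩

M : G5 → G5
M G = ⟨ [ atom p1 ] ∣ [ G ] ⟩

P : G5 → G5
P G = ⟨ [ G ] ∣ [ atom m2 ] ⟩

P⋆ : G5 → G5
P⋆ G = ⟨ [ G ] ∣ [ star ] ⟩

Pn : ℕ → G5 → G5
Pn zero = P⋆
Pn (suc zero) = P
Pn (suc (suc n)) = Pn n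

Gseq : ℕ → G5
Gseq zero = atom z0
Gseq (suc n) = M (Pn n (Gseq n))

{-# OPTIONS --safe #-}
-- Induction on n: the only right option of Gₙ₊₁ is Pₙ(Gₙ), which 0 beats by
-- moving to its left option Gₙ, while 0 ⊲ Gₙ₊₁ through its left option 1 ≥ 0.
module Submission where

open import Defs
open import Data.Nat using (ℕ; zero; suc; z≤n; s≤s)
open import Data.List.NonEmpty using (List⁺; _∷_)
open import Data.List using (List)
open import Data.List.Relation.Unary.All using ([]; _∷_)
open import Data.List.Relation.Unary.Any using (here)
open import Data.Fin.Properties using (≤-refl)

≤⇒⊲-firstLeft : {A : Set} {_≼_ : A → A → Set} {G H : Game A}
                {Hs : List (Game A)} {R : List⁺ (Game A)} →
                Order._≤G_ _≼_ G H → Order._⊲_ _≼_ G ⟨ H ∷ Hs ∣ R ⟩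
≤⇒⊲-firstLeft G≤H = Order.tf-left (here G≤H)

zero⊲Pn : ∀ n G → atom z0 ≤G G → atom z0 ⊲ Pn n G
zero⊲Pn zero          G 0≤G = ≤⇒⊲-firstLeft 0≤G
zero⊲Pn (suc zero)    G 0≤G = ≤⇒⊲-firstLeft 0≤G
zero⊲Pn (suc (suc n)) G 0≤G = zero⊲Pn n G 0≤G

zero≤one : atom z0 ≤G atom p1
zero≤one = le [] [] (λ _ → tf-atom (s≤s (s≤s (s≤s z≤n))))

zero≤M : ∀ G → atom z0 ⊲ G → atom z0 ≤G M G
zero≤M G 0⊲G = le [] (0⊲G ∷ []) (λ _ → ≤⇒⊲-firstLeft zero≤one)

corollary3 : (n : ℕ) → atom z0 ≤G Gseq n
corollary3 zero    = le [] [] (λ _ → tf-atom (≤-refl {x = z0}))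
corollary3 (suc n) = zero≤M (Pn n (Gseq n)) (zero⊲Pn n (Gseq n) (corollary3 n))
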